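{- Let $S\subset \mathbb{Z}^n$ be a set that has a realization $(T,W)$ with $T$ a tree. Then any two realizations $(T,W)$ and $(T',W')$ of $S$ in which $T$ and $T'$ are trees are equivalent.
   Context: All graphs are finite, simple and connected. For a graph $G$ and an ordered vertex subset $W=\{\omega^1,\dots,\omega^n\}$, $r(u\mid W)=(d(u,\omega^1),\dots,d(u,\omega^n))$; $W$ is resolving if these vectors are pairwise distinct. $(G,W)$ is a realization of a finite $S\subset\mathbb{Z}^n$ if $W$ is a resolving set of $G$ and $S=\{r(u\mid W):u\in V(G)\}$. Two realizations $(G,W)$ and $(G',W')$ of $S$ are equivalent if the map $f:V(G)\to V(G')$ with $r(u\mid W)=r(f(u)\mid W')$ is a graph isomorphism. -}

module Defs where

open import Data.Nat using (ℕ; zero; suc; _≤_)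
open import Data.Integer using (ℤ; +_)
open import Data.Fin using (Fin)
open import Data.Vec using (Vec; lookup)
open import Data.List using (List; []; _∷_; _++_; length)
open import Data.List.Relation.Unary.Unique.Propositional using (Unique)
open import Data.Bool using (Bool; true; false)
open import Data.Product using (Σ; _×_; ∃)
open import Data.Unit using (⊤)
open import Data.Empty using (⊥)
open import Relation.Nullary using (¬_)
open import Relation.Binary.PropositionalEquality using (_≡_)
open import Function.Bundles using (_⇔_)
open import Function.Definitions using (Injective; Bijective)

record Graph (m : ℕ) : Set where
  field
    adj   : Fin m → Fin m → Bool
    sym   : ∀ u v → adj u v ≡ adj v u
    irrefl : ∀ u → adj u u ≡ false

open Graph public

Adj : ∀ {m} → Graph m → Fin m → Fin m → Set
Adj G u v = adj G u v ≡ true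

data Walk {m} (G : Graph m) : Fin m → Fin m → ℕ → Set where
  here : ∀ {u} → Walk G u u 0
  step : ∀ {u w v k} → Adj G u w → Walk G w v k → Walk G u v (suc k)

Connected : ∀ {m} → Graph m → Set
Connected {m} G = (u v : Fin m) → ∃ λ k → Walk G u v k

Dist : ∀ {m} → Graph m → Fin m → Fin m → ℕ → Set
Dist G u v k = Walk G u v k × (∀ j → Walk G u v j → k ≤ j)

AdjChain : ∀ {m} → Graph m → List (Fin m) → Set
AdjChain G [] = ⊤
AdjChain G (x ∷ []) = ⊤
AdjChain G (x ∷ y ∷ r) = Adj G x y × AdjChain G (y ∷ r)

IsCycle : ∀ {m} → Graph m → List (Fin m) → Set
IsCycle G [] = ⊥
IsCycle G (v ∷ ws) = 2 ≤ length ws × Unique (v ∷ ws) × AdjChain G (v ∷ ws ++ v ∷ [])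

Acyclic : ∀ {m} → Graph m → Set
Acyclic G = ∀ vs → ¬ IsCycle G vs

IsTree : ∀ {m} → Graph m → Set
IsTree G = Connected G × Acyclic G

Rep : ∀ {m n} → Graph m → Vec (Fin m) n → Fin m → Vec ℤ n → Set
Rep {n = n} G W u x = (i : Fin n) → Σ ℕ λ k → Dist G u (lookup W i) k × lookup x i ≡ + k

Resolving : ∀ {m n} → Graph m → Vec (Fin m) n → Set
Resolving {m} G W = ∀ (u v : Fin m) x → Rep G W u x → Rep G W v x → u ≡ v

Realization : ∀ {m n} → (Vec ℤ n → Set) → Graph m → Vec (Fin m) n → Set
Realization {m} S G W =
  Connected G × Injective _≡_ _≡_ (lookup W) × Resolving G W ×
  (∀ x → S x ⇔ (∃ λ (u : Fin m) → Rep G W u x))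

Equivalent : ∀ {m m' n} → Graph m → Vec (Fin m) n → Graph m' → Vec (Fin m') n → Set
Equivalent {m} {m'} G W G' W' =
  Σ (Fin m → Fin m') λ f →
    (∀ u x → Rep G W u x → Rep G' W' (f u) x) ×
    Bijective _≡_ _≡_ f ×
    (∀ u v → Adj G u v ⇔ Adj G' (f u) (f v))

-- Along an edge uv of a tree, the distance to any vertex t changes by exactly
-- one, so the edge splits the vertices into the side nearer to u and the side
-- nearer to v, and a geodesic between the two sides crosses uv.  This lets one
-- read adjacency off the set S of distance vectors alone: r(u) and r(v) are
-- adjacent iff they differ by exactly one in every coordinate and it is not the
-- case that each of them lies one above (in every coordinate) a vector of S
-- other than the other one.  For an edge uv, a vertex c with r(u) = r(c) + 1
-- lies on the same side of uv as all the landmarks; on v's side this forces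
-- r(c) = r(v), on u's side it forces every vector one below r(v) to be r(u).
-- For a non-edge, the first vertex after u on the geodesic to v lies one below
-- r(u), and symmetrically for v.  Hence two tree realizations of S have the
-- same adjacency.

module Submission where

open import Defs
open import Data.Bool using (true)
import Data.Bool.Properties as Bool
open import Data.Empty using (⊥; ⊥-elim)
open import Data.Fin using (Fin)
open import Data.Fin.Properties using (any?) renaming (_≟_ to _≟ᶠ_)
open import Data.Integer using (ℤ; +_) renaming (suc to sucℤ)
open import Data.Integer.Properties using () renaming (+-injective to +-injectiveℤ)
open import Data.List using (List; []; _∷_; _++_; length)
open import Data.List.Membership.Propositional using (_∈_; _∉_)
import Data.List.Membership.DecPropositional as DecMembership
open import Data.List.Relation.Binary.Subset.Propositional using (_⊆_)
import Data.List.Relation.Unary.All as All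
open import Data.List.Relation.Unary.All.Properties using (¬Any⇒All¬; All¬⇒¬Any)
open import Data.List.Relation.Unary.Any using (here; there)
open import Data.List.Relation.Unary.AllPairs using ([]; _∷_)
open import Data.List.Relation.Unary.Unique.Propositional using (Unique)
open import Data.Nat using (ℕ; zero; suc; _+_; _≤_; _<_; z≤n; s≤s)
open import Data.Nat.Properties
open import Data.Product using (∃; ∃₂; _×_; _,_; proj₁; proj₂)
open import Data.Sum using (_⊎_; inj₁; inj₂; [_,_]′)
import Data.Sum as Sum
open import Data.Unit using (tt)
open import Data.Vec using (Vec; lookup; tabulate)
open import Data.Vec.Properties using (lookup∘tabulate; tabulate∘lookup; tabulate-cong)
open import Function using (_∘_; id)
open import Function.Bundles using (_⇔_; mk⇔; Equivalence)
open import Function.Construct.Composition using (_⇔-∘_)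
open import Function.Construct.Symmetry using (⇔-sym)
open import Function.Definitions using (Injective; Surjective)
open import Relation.Binary.Definitions using (tri<; tri≈; tri>)
open import Relation.Binary.PropositionalEquality as ≡
  using (_≡_; _≢_; refl; trans; cong; subst; subst₂)
open import Relation.Nullary using (¬_; yes; no; Dec; contradiction)
open import Relation.Nullary.Decidable using (_×-dec_)
open import Relation.Unary using (Decidable)

least : {P : ℕ → Set} → Decidable P → ∀ {k} → P k →
        ∃ λ j → P j × (∀ {i} → P i → j ≤ i)
least {P} P? {k} pk = [ id , (λ none → ⊥-elim (none ≤-refl pk)) ]′ (search (suc k))
  where
  search : ∀ b → (∃ λ j → P j × (∀ {i} → P i → j ≤ i)) ⊎ (∀ {i} → i < b → ¬ P i)
  search zero = inj₂ λ ()
  search (suc b) with search b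
  ... | inj₁ found = inj₁ found
  ... | inj₂ none with P? b
  ...   | yes pb = inj₁ (b , pb , λ pi → ≮⇒≥ λ i<b → none i<b pi)
  ...   | no ¬pb = inj₂ λ i<1+b pi →
            [ (λ i<b → none i<b pi) , (λ { refl → ¬pb pi }) ]′ (m<1+n⇒m<n∨m≡n i<1+b)

module Walks {m : ℕ} (G : Graph m) where

  open DecMembership (_≟ᶠ_ {m}) using (_∈?_)

  adj-sym : ∀ {u v} → Adj G u v → Adj G v u
  adj-sym {u} {v} e = trans (Defs.sym G v u) e

  adj-irrefl : ∀ {u} → ¬ Adj G u u
  adj-irrefl {u} e = contradiction (trans (≡.sym e) (irrefl G u)) λ ()

  walk-0 : ∀ {u v} → Walk G u v 0 → u ≡ v
  walk-0 here = refl

  verts : ∀ {u v k} → Walk G u v k → List (Fin m)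
  verts {u} here = u ∷ []
  verts {u} (step _ p) = u ∷ verts p

  end∈verts : ∀ {u v k} (p : Walk G u v k) → v ∈ verts p
  end∈verts here = here refl
  end∈verts (step _ p) = there (end∈verts p)

  _++ʷ_ : ∀ {u v w i j} → Walk G u v i → Walk G v w j → Walk G u w (i + j)
  here ++ʷ q = q
  step e p ++ʷ q = step e (p ++ʷ q)

  ∈-++ʷ⁻ : ∀ {u v w i j x} (p : Walk G u v i) (q : Walk G v w j) →
           x ∈ verts (p ++ʷ q) → x ∈ verts p ⊎ x ∈ verts q
  ∈-++ʷ⁻ here q x∈ = inj₂ x∈
  ∈-++ʷ⁻ (step _ p) q (here eq) = inj₁ (here eq)
  ∈-++ʷ⁻ (step _ p) q (there x∈) = Sum.map₁ there (∈-++ʷ⁻ p q x∈)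

  snoc : ∀ {u v w k} → Walk G u v k → Adj G v w → Walk G u w (suc k)
  snoc here e = step e here
  snoc (step e′ p) e = step e′ (snoc p e)

  ∈-snoc⁻ : ∀ {u v w k x} (p : Walk G u v k) (e : Adj G v w) →
            x ∈ verts (snoc p e) → x ∈ verts p ⊎ x ≡ w
  ∈-snoc⁻ here e (here eq) = inj₁ (here eq)
  ∈-snoc⁻ here e (there (here eq)) = inj₂ eq
  ∈-snoc⁻ (step _ p) e (here eq) = inj₁ (here eq)
  ∈-snoc⁻ (step _ p) e (there x∈) = Sum.map₁ there (∈-snoc⁻ p e x∈)

  reverse : ∀ {u v k} → Walk G u v k → Walk G v u k
  reverse here = here
  reverse (step e p) = snoc (reverse p) (adj-sym e)

  ∈-reverse⁻ : ∀ {u v k x} (p : Walk G u v k) → x ∈ verts (reverse p) → x ∈ verts p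
  ∈-reverse⁻ here x∈ = x∈
  ∈-reverse⁻ (step e p) x∈ with ∈-snoc⁻ (reverse p) (adj-sym e) x∈
  ... | inj₁ x∈p = there (∈-reverse⁻ p x∈p)
  ... | inj₂ refl = here refl

  splitAt : ∀ {u v k x} (p : Walk G u v k) → x ∈ verts p →
            ∃₂ λ i j → i + j ≡ k × Walk G u x i × Walk G x v j
  splitAt here (here refl) = 0 , 0 , refl , here , here
  splitAt (step e p) (here refl) = 0 , _ , refl , here , step e p
  splitAt (step e p) (there x∈) with splitAt p x∈
  ... | i , j , refl , p₁ , p₂ = suc i , j , refl , step e p₁ , p₂

  record PathWithin (vs : List (Fin m)) (u v : Fin m) : Set where
    constructor path
    field
      {len}  : ℕ
      walk   : Walk G u v len
      unique : Unique (verts walk)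
      within : verts walk ⊆ vs

  widen : ∀ {vs ws u v} → vs ⊆ ws → PathWithin vs u v → PathWithin ws u v
  widen vs⊆ws (path p up p⊆vs) = path p up (vs⊆ws ∘ p⊆vs)

  suffixFrom : ∀ {u v k x} (p : Walk G u v k) → Unique (verts p) → x ∈ verts p →
               PathWithin (verts p) x v
  suffixFrom here up (here refl) = path here up id
  suffixFrom (step e p) up (here refl) = path (step e p) up id
  suffixFrom (step e p) (_ ∷ up) (there x∈) = widen there (suffixFrom p up x∈)

  shorten : ∀ {u v k} (p : Walk G u v k) → PathWithin (verts p) u v
  shorten here = path here (All.[] ∷ []) id
  shorten {u} (step e p) with shorten p
  ... | path q uq q⊆p with u ∈? verts q
  ...   | yes u∈q = widen (there ∘ q⊆p) (suffixFrom q uq u∈q)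
  ...   | no u∉q = path (step e q) (¬Any⇒All¬ (verts q) u∉q ∷ uq) step⊆
    where
    step⊆ : verts (step e q) ⊆ verts (step e p)
    step⊆ (here eq) = here eq
    step⊆ (there x∈) = there (q⊆p x∈)

  closingChain : ∀ {a x y b k} → Adj G a x → (p : Walk G x y k) → Adj G y b →
                 AdjChain G (a ∷ verts p ++ b ∷ [])
  closingChain e₁ here e₂ = e₁ , e₂ , tt
  closingChain e₁ (step e p) e₂ = e₁ , closingChain e p e₂

  path-closes-cycle : ∀ {a x y k} (p : Walk G x y (suc k)) → Unique (verts p) →
                      a ∉ verts p → Adj G a x → Adj G y a → IsCycle G (a ∷ verts p)
  path-closes-cycle p up a∉p e₁ e₂ = two≤ p , ¬Any⇒All¬ (verts p) a∉p ∷ up , closingChain e₁ p e₂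
    where
    two≤ : ∀ {x y k} (p : Walk G x y (suc k)) → 2 ≤ length (verts p)
    two≤ (step _ here) = s≤s (s≤s z≤n)
    two≤ (step _ (step _ _)) = s≤s (s≤s z≤n)

  -- The two paths, minus their first edges and glued at t, close a cycle with ab.
  edge-separates-paths : Acyclic G → ∀ {a b t k l} → Adj G a b →
                         (p : Walk G b t k) → Unique (verts p) → a ∉ verts p →
                         (q : Walk G a t l) → Unique (verts q) → b ∉ verts q → ⊥
  edge-separates-paths _ _ here _ _ q _ b∉q = b∉q (end∈verts q)
  edge-separates-paths _ _ p@(step _ _) _ a∉p here _ _ = a∉p (end∈verts p)
  edge-separates-paths acyclic {a} {b} e (step e₁ p) (b∉p ∷ up) a∉p (step e₂ q) (a∉q ∷ uq) b∉q =
    acyclic (a ∷ b ∷ verts r)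
      (path-closes-cycle (step e₁ r) (¬Any⇒All¬ (verts r) b∉r ∷ ur) a∉br e (adj-sym e₂))
    where
    open PathWithin (shorten (p ++ʷ reverse q)) renaming (walk to r; unique to ur; within to r⊆)
    r-verts : ∀ {x} → x ∈ verts r → x ∈ verts p ⊎ x ∈ verts q
    r-verts x∈ = Sum.map₂ (∈-reverse⁻ q) (∈-++ʷ⁻ p (reverse q) (r⊆ x∈))
    b∉r : b ∉ verts r
    b∉r b∈ = [ All¬⇒¬Any b∉p , b∉q ∘ there ]′ (r-verts b∈)
    a∉br : a ∉ b ∷ verts r
    a∉br (here refl) = adj-irrefl e
    a∉br (there a∈) = [ a∉p ∘ there , All¬⇒¬Any a∉q ]′ (r-verts a∈)

  edge-separates : Acyclic G → ∀ {a b t k l} → Adj G a b →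
                   (p : Walk G b t k) → a ∉ verts p → (q : Walk G a t l) → b ∉ verts q → ⊥
  edge-separates acyclic e p a∉p q b∉q with shorten p | shorten q
  ... | path p′ up p′⊆p | path q′ uq q′⊆q =
    edge-separates-paths acyclic e p′ up (a∉p ∘ p′⊆p) q′ uq (b∉q ∘ q′⊆q)

  walk? : ∀ u v k → Dec (Walk G u v k)
  walk? u v zero with u ≟ᶠ v
  ... | yes refl = yes here
  ... | no u≢v = no λ { here → u≢v refl }
  walk? u v (suc k) with any? (λ w → (adj G u w Bool.≟ true) ×-dec walk? w v k)
  ... | yes (w , e , p) = yes (step e p)
  ... | no ∄w = no λ { (step e p) → ∄w (_ , e , p) }

module Distances {m : ℕ} (G : Graph m) (connected : Connected G) where

  open Walks G

  shortest : ∀ u v → ∃ λ k → Walk G u v k × (∀ {j} → Walk G u v j → k ≤ j)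
  shortest u v = least (walk? u v) (proj₂ (connected u v))

  d : Fin m → Fin m → ℕ
  d u v = proj₁ (shortest u v)

  geodesic : ∀ u v → Walk G u v (d u v)
  geodesic u v = proj₁ (proj₂ (shortest u v))

  d-minimal : ∀ {u v k} → Walk G u v k → d u v ≤ k
  d-minimal {u} {v} = proj₂ (proj₂ (shortest u v))

  d-Dist : ∀ {u v} → Dist G u v (d u v)
  d-Dist {u} {v} = geodesic u v , λ _ → d-minimal

  Dist⇒≡d : ∀ {u v k} → Dist G u v k → k ≡ d u v
  Dist⇒≡d {u} {v} (p , minimal) = ≤-antisym (minimal _ (geodesic u v)) (d-minimal p)

  d-sym : ∀ u v → d u v ≡ d v u
  d-sym u v = ≤-antisym (d-minimal (reverse (geodesic v u))) (d-minimal (reverse (geodesic u v)))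

  d≡0⇒≡ : ∀ {u v} → d u v ≡ 0 → u ≡ v
  d≡0⇒≡ {u} {v} eq = walk-0 (subst (Walk G u v) eq (geodesic u v))

  d-adj-≤ : ∀ {a b} t → Adj G a b → d a t ≤ suc (d b t)
  d-adj-≤ {b = b} t e = d-minimal (step e (geodesic b t))

  d-through : ∀ {u v k x} (p : Walk G u v k) → x ∈ verts p → d u x + d x v ≤ k
  d-through p x∈ with splitAt p x∈
  ... | _ , _ , refl , p₁ , p₂ = +-mono-≤ (d-minimal p₁) (d-minimal p₂)

  ∉-short-walk : ∀ {a b t k} → Adj G a b → (p : Walk G a t k) → k ≤ d b t → b ∉ verts p
  ∉-short-walk e p k≤ b∈p with splitAt p b∈p
  ... | zero , _ , refl , p₁ , _ = adj-irrefl (subst (Adj G _) (≡.sym (walk-0 p₁)) e)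
  ... | suc i , j , refl , _ , p₂ =
    <-irrefl refl (≤-trans (s≤s (m≤n+m j i)) (≤-trans k≤ (d-minimal p₂)))

  next-hop : ∀ {u v} → u ≢ v → ∃ λ c → Adj G u c × d u v ≡ suc (d c v)
  next-hop {u} {v} u≢v = hop u≢v (geodesic u v) ≤-refl
    where
    hop : ∀ {x k} → x ≢ v → Walk G x v k → k ≤ d x v → ∃ λ c → Adj G x c × d x v ≡ suc (d c v)
    hop x≢v here _ = ⊥-elim (x≢v refl)
    hop _ (step {w = c} e q) k≤ =
      c , e , ≤-antisym (d-adj-≤ v e) (≤-trans (s≤s (d-minimal q)) k≤)

module TreeDistances {m : ℕ} (G : Graph m) (connected : Connected G) (acyclic : Acyclic G) where

  open Walks G
  open Distances G connected
  open DecMembership (_≟ᶠ_ {m}) using (_∈?_)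

  NearerTo : Fin m → Fin m → Fin m → Set
  NearerTo a b t = d b t ≡ suc (d a t)

  nearer⇒≤ : ∀ {a b t} → NearerTo a b t → d a t ≤ d b t
  nearer⇒≤ {a} {t = t} eq = subst (d a t ≤_) (≡.sym eq) (n≤1+n _)

  adj⇒d≢ : ∀ {a b} t → Adj G a b → d a t ≢ d b t
  adj⇒d≢ {a} {b} t e eq =
    edge-separates acyclic e
      (geodesic b t) (∉-short-walk (adj-sym e) (geodesic b t) (≤-reflexive (≡.sym eq)))
      (geodesic a t) (∉-short-walk e (geodesic a t) (≤-reflexive eq))

  adj⇒nearer : ∀ {a b} t → Adj G a b → NearerTo a b t ⊎ NearerTo b a t
  adj⇒nearer {a} {b} t e with <-cmp (d a t) (d b t)
  ... | tri< lt _ _ = inj₁ (≤-antisym (d-adj-≤ t (adj-sym e)) lt)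
  ... | tri≈ _ eq _ = ⊥-elim (adj⇒d≢ t e eq)
  ... | tri> _ _ gt = inj₂ (≤-antisym (d-adj-≤ t e) gt)

  -- The geodesic from s to t passes through a: otherwise the walk b → s → t
  -- and the geodesic from a to t would contradict edge-separates.
  crossing : ∀ {a b s t} → Adj G a b → NearerTo a b t → NearerTo b a s →
             d s t ≡ suc (d b s + d a t)
  crossing {a} {b} {s} {t} e t-near-a s-near-b = ≤-antisym upper lower
    where
    upper : d s t ≤ suc (d b s + d a t)
    upper = subst (λ k → d s t ≤ k + d a t) (trans (d-sym s a) s-near-b)
                  (d-minimal (geodesic s a ++ʷ geodesic a t))
    lower : suc (d b s + d a t) ≤ d s t
    lower with a ∈? verts (geodesic s t)
    ... | yes a∈ = subst (λ k → k + d a t ≤ d s t) (trans (d-sym s a) s-near-b)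
                         (d-through (geodesic s t) a∈)
    ... | no a∉ = ⊥-elim (edge-separates acyclic e (geodesic b s ++ʷ geodesic s t) a∉bst
                                        (geodesic a t) b∉at)
      where
      a∉bst : a ∉ verts (geodesic b s ++ʷ geodesic s t)
      a∉bst a∈ = [ ∉-short-walk (adj-sym e) (geodesic b s) (nearer⇒≤ s-near-b) , a∉ ]′
                   (∈-++ʷ⁻ (geodesic b s) (geodesic s t) a∈)
      b∉at : b ∉ verts (geodesic a t)
      b∉at = ∉-short-walk e (geodesic a t) (nearer⇒≤ t-near-a)

  nearer-u-propagates : ∀ {u v c t} → Adj G u v → d u t ≡ suc (d c t) →
                        NearerTo u v c → NearerTo u v t
  nearer-u-propagates {u} {v} {c} {t} e c-step c-near-u with adj⇒nearer t e
  ... | inj₁ t-near-u = t-near-u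
  ... | inj₂ t-near-v = ⊥-elim (m≢1+n+m (d v t) (begin
        d v t  ≡⟨ suc-injective (trans (≡.sym c-step) t-near-v) ⟨
        d c t  ≡⟨ crossing (adj-sym e) t-near-v c-near-u ⟩
        suc (d u c + d v t) ∎))
    where open ≡.≡-Reasoning

  nearer-v-propagates : ∀ {u v c t} → Adj G u v → d u t ≡ suc (d c t) →
                        NearerTo v u c → NearerTo v u t
  nearer-v-propagates {u} {v} {c} {t} e c-step c-near-v with adj⇒nearer t e
  ... | inj₂ t-near-v = t-near-v
  ... | inj₁ t-near-u = ⊥-elim (m≢1+n+m (d u t) (begin
        d u t                      ≡⟨ c-step ⟩
        suc (d c t)                ≡⟨ cong suc (crossing e t-near-u c-near-v) ⟩
        suc (suc (d v c + d u t))  ∎))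
    where open ≡.≡-Reasoning

Covers : ∀ {n} → Vec ℤ n → Vec ℤ n → Set
Covers x z = ∀ i → lookup x i ≡ sucℤ (lookup z i)

UnitApart : ∀ {n} → Vec ℤ n → Vec ℤ n → Set
UnitApart x y = ∀ i → lookup y i ≡ sucℤ (lookup x i) ⊎ lookup x i ≡ sucℤ (lookup y i)

CoversOtherThan : ∀ {n} → (Vec ℤ n → Set) → Vec ℤ n → Vec ℤ n → Set
CoversOtherThan S x y = ∃ λ z → S z × z ≢ y × Covers x z

TreeAdjacent : ∀ {n} → (Vec ℤ n → Set) → Vec ℤ n → Vec ℤ n → Set
TreeAdjacent S x y = x ≢ y × UnitApart x y × ¬ (CoversOtherThan S x y × CoversOtherThan S y x)

module Realized {n m : ℕ} {S : Vec ℤ n → Set} {G : Graph m} (W : Vec (Fin m) n)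
                (R : Realization S G W) where

  open Distances G (proj₁ R) public

  private
    resolving : Resolving G W
    resolving = proj₁ (proj₂ (proj₂ R))

    S⇔realized : ∀ x → S x ⇔ ∃ λ u → Rep G W u x
    S⇔realized = proj₂ (proj₂ (proj₂ R))

  landmark : Fin n → Fin m
  landmark = lookup W

  rep : Fin m → Vec ℤ n
  rep u = tabulate λ i → + d u (landmark i)

  lookup-rep : ∀ u i → lookup (rep u) i ≡ + d u (landmark i)
  lookup-rep u i = lookup∘tabulate (λ i → + d u (landmark i)) i

  rep-Rep : ∀ u → Rep G W u (rep u)
  rep-Rep u i = d u (landmark i) , d-Dist , lookup-rep u i

  Rep⇒≡rep : ∀ {u x} → Rep G W u x → x ≡ rep u
  Rep⇒≡rep {x = x} r = trans (≡.sym (tabulate∘lookup x)) (tabulate-cong coordinate)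
    where
    coordinate : ∀ i → lookup x i ≡ + d _ (landmark i)
    coordinate i with r i
    ... | _ , D , x≡ = trans x≡ (cong +_ (Dist⇒≡d D))

  rep-injective : ∀ {u v} → rep u ≡ rep v → u ≡ v
  rep-injective {u} {v} eq = resolving u v (rep v) (subst (Rep G W u) eq (rep-Rep u)) (rep-Rep v)

  rep-≡ : ∀ {u v} → (∀ i → d u (landmark i) ≡ d v (landmark i)) → rep u ≡ rep v
  rep-≡ eq = tabulate-cong (cong +_ ∘ eq)

  rep-∈S : ∀ u → S (rep u)
  rep-∈S u = Equivalence.from (S⇔realized (rep u)) (u , rep-Rep u)

  S⇒rep : ∀ {x} → S x → ∃ λ u → x ≡ rep u
  S⇒rep {x} Sx with Equivalence.to (S⇔realized x) Sx
  ... | u , r = u , Rep⇒≡rep r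

  rep-suc⁺ : ∀ {u c} i → d u (landmark i) ≡ suc (d c (landmark i)) →
             lookup (rep u) i ≡ sucℤ (lookup (rep c) i)
  rep-suc⁺ {u} {c} i eq rewrite lookup-rep u i | lookup-rep c i = cong +_ eq

  rep-suc⁻ : ∀ {u c} i → lookup (rep u) i ≡ sucℤ (lookup (rep c) i) →
             d u (landmark i) ≡ suc (d c (landmark i))
  rep-suc⁻ {u} {c} i eq rewrite lookup-rep u i | lookup-rep c i = +-injectiveℤ eq

module TreeRealized {n m : ℕ} {S : Vec ℤ n → Set} {G : Graph m} (W : Vec (Fin m) n)
                    (tree : IsTree G) (R : Realization S G W) where

  open Walks G using (adj-sym; adj-irrefl)
  open Realized W R
  open TreeDistances G (proj₁ R) (proj₂ tree)

  adj⇒unitApart : ∀ {u v} → Adj G u v → UnitApart (rep u) (rep v)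
  adj⇒unitApart e i = Sum.map (rep-suc⁺ i) (rep-suc⁺ i) (adj⇒nearer (landmark i) e)

  -- Whichever side of uv the vertex c₁ below r(u) is on, all landmarks follow it.
  adj⇒¬coversBoth : ∀ {u v} → Adj G u v →
                    ¬ (CoversOtherThan S (rep u) (rep v) × CoversOtherThan S (rep v) (rep u))
  adj⇒¬coversBoth e ((z₁ , Sz₁ , z₁≢ , covers₁) , (z₂ , Sz₂ , z₂≢ , covers₂))
    with S⇒rep Sz₁ | S⇒rep Sz₂
  ... | c₁ , refl | c₂ , refl with adj⇒nearer c₁ e
  ... | inj₁ c₁-near-u = z₂≢ (rep-≡ λ i →
          suc-injective (trans (≡.sym (rep-suc⁻ i (covers₂ i)))
                               (nearer-u-propagates e (rep-suc⁻ i (covers₁ i)) c₁-near-u)))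
  ... | inj₂ c₁-near-v = z₁≢ (rep-≡ λ i →
          suc-injective (trans (≡.sym (rep-suc⁻ i (covers₁ i)))
                               (nearer-v-propagates e (rep-suc⁻ i (covers₁ i)) c₁-near-v)))

  ¬adj⇒covers : ∀ {u v} → ¬ Adj G u v → u ≢ v → UnitApart (rep u) (rep v) →
                CoversOtherThan S (rep u) (rep v)
  ¬adj⇒covers {u} {v} ¬e u≢v apart with next-hop u≢v
  ... | c , e , v-near-c = rep c , rep-∈S c , c≢v ∘ rep-injective , λ i → rep-suc⁺ i (c-below i)
    where
    c≢v : c ≢ v
    c≢v refl = ¬e e
    c-below : ∀ i → d u (landmark i) ≡ suc (d c (landmark i))
    c-below i with adj⇒nearer (landmark i) e
    ... | inj₂ t-near-c = t-near-c
    ... | inj₁ t-near-u with Sum.map (rep-suc⁻ i) (rep-suc⁻ i) (apart i)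
    ...   | inj₁ v-above = ⊥-elim (c≢v (d≡0⇒≡ (+-cancelʳ-≡ _ _ 0
              (suc-injective (trans (≡.sym (crossing e t-near-u v-near-c)) v-above)))))
    ...   | inj₂ v-below =
      ⊥-elim (m≢1+n+m _ (trans v-below (cong suc (crossing e t-near-u v-near-c))))

  treeAdjacent⇒adj : ∀ {u v} → TreeAdjacent S (rep u) (rep v) → Adj G u v
  treeAdjacent⇒adj {u} {v} (rep≢ , apart , ¬both) with adj G u v Bool.≟ true
  ... | yes e = e
  ... | no ¬e = ⊥-elim (¬both ( ¬adj⇒covers ¬e u≢v apart
                              , ¬adj⇒covers (¬e ∘ adj-sym) (u≢v ∘ ≡.sym) (Sum.swap ∘ apart)))
    where
    u≢v : u ≢ v
    u≢v refl = rep≢ refl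

  adj⇔treeAdjacent : ∀ {u v} → Adj G u v ⇔ TreeAdjacent S (rep u) (rep v)
  adj⇔treeAdjacent {u} {v} = mk⇔ adj⇒treeAdjacent treeAdjacent⇒adj
    where
    adj⇒treeAdjacent : Adj G u v → TreeAdjacent S (rep u) (rep v)
    adj⇒treeAdjacent e =
      (λ eq → adj-irrefl (subst (Adj G u) (≡.sym (rep-injective eq)) e)) ,
      adj⇒unitApart e , adj⇒¬coversBoth e

realizations-equivalent :
  ∀ {n m m′} {S : Vec ℤ n → Set} {G : Graph m} {G′ : Graph m′}
  (W : Vec (Fin m) n) (R : Realization S G W) (W′ : Vec (Fin m′) n) (R′ : Realization S G′ W′)
  (C : Vec ℤ n → Vec ℤ n → Set) →
  (∀ {u v} → Adj G u v ⇔ C (Realized.rep W R u) (Realized.rep W R v)) →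
  (∀ {u v} → Adj G′ u v ⇔ C (Realized.rep W′ R′ u) (Realized.rep W′ R′ v)) →
  Equivalent G W G′ W′
realizations-equivalent {G = G} {G′ = G′} W R W′ R′ C adj⇔C adj′⇔C =
  f , transport , (f-injective , f-surjective) , λ u v → ⇔-sym (adj′-f u v) ⇔-∘ adj⇔C
  where
  module A = Realized W R
  module B = Realized W′ R′

  f-spec : ∀ u → ∃ λ u′ → A.rep u ≡ B.rep u′
  f-spec u = B.S⇒rep (A.rep-∈S u)

  f : Fin _ → Fin _
  f u = proj₁ (f-spec u)

  f-rep : ∀ u → A.rep u ≡ B.rep (f u)
  f-rep u = proj₂ (f-spec u)

  transport : ∀ u x → Rep G W u x → Rep G′ W′ (f u) x
  transport u x r =
    subst (Rep G′ W′ (f u)) (≡.sym (trans (A.Rep⇒≡rep {x = x} r) (f-rep u))) (B.rep-Rep (f u))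

  f-injective : Injective _≡_ _≡_ f
  f-injective {u} {v} eq = A.rep-injective (trans (f-rep u) (trans (cong B.rep eq) (≡.sym (f-rep v))))

  f-surjective : Surjective _≡_ _≡_ f
  f-surjective u′ with A.S⇒rep (B.rep-∈S u′)
  ... | u , eq = u , λ { refl → B.rep-injective (trans (≡.sym (f-rep u)) (≡.sym eq)) }

  adj′-f : ∀ u v → Adj G′ (f u) (f v) ⇔ C (A.rep u) (A.rep v)
  adj′-f u v =
    subst₂ (λ x y → Adj G′ (f u) (f v) ⇔ C x y) (≡.sym (f-rep u)) (≡.sym (f-rep v)) adj′⇔C

proposition4p4 : (n : ℕ) (S : Vec ℤ n → Set)
                 (m : ℕ) (T : Graph m) (W : Vec (Fin m) n)
                 (m' : ℕ) (T' : Graph m') (W' : Vec (Fin m') n) →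
                 IsTree T → Realization S T W →
                 IsTree T' → Realization S T' W' →
                 Equivalent T W T' W'
proposition4p4 n S m T W m' T' W' tree R tree' R' =
  realizations-equivalent W R W' R' (TreeAdjacent S)
    (TreeRealized.adj⇔treeAdjacent W tree R) (TreeRealized.adj⇔treeAdjacent W' tree' R')
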